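{- Let $L$ be a finite semidistributive lattice, let $I=[a,b]$ be an interval in $L$, and let $\mathcal{E}$ be the edge set of the canonical join graph of $L$. Then the doubled lattice $L[I]$ is semidistributive, and the edge set of the canonical join graph of $L[I]$ is \[\mathcal{E}'\uplus\bigl\{\{(j,0),(a,1)\} : j\in\mathrm{can}(w)\text{ for some } w\in I,\ j\not\le a\bigr\},\] where $\mathcal{E}'$ is the set of pairs $\{(j,\epsilon),(j',\epsilon')\}$ such that $\{j,j'\}\in\mathcal{E}$ and $(j,\epsilon)$, $(j',\epsilon')$ are the minimal elements of the fibers $\pi_I^{ -1}(j)$ and $\pi_I^{ -1}(j')$ respectively.
   Context: Doubling: let $\mathbf{2}$ be the chain $0<1$. For an interval $I=[a,b]$ of $L$, let $X=\{x\in L: x\ge a\}$ (the elements lying above some element of $I$), and let $L[I]$ be the induced subposet of $L\times\mathbf{2}$ (componentwise order) on $\bigl(((L\setminus X)\cup I)\times\{0\}\bigr)\uplus(X\times\{1\})$. It is a lattice and $\pi_I:L[I]\to L$, $(x,\epsilon)\mapsto x$, is a surjective lattice homomorphism. For a finite lattice, a join $\bigvee A$ is irredundant if no proper subset has the same join; the canonical join representation $\mathrm{can}(w)$ is the unique minimal irredundant $A$ with $\bigvee A=w$ under join-refinement ($A$ refines $B$ if each element of $A$ lies below some element of $B$). Semidistributive: $x\vee y=x\vee z\Rightarrow x\vee(y\wedge z)=x\vee y$ and dually $x\wedge y=x\wedge z\Rightarrow x\wedge(y\vee z)=x\wedge y$. The canonical join graph is the graph on the join-irreducible elements whose edges are the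 2-element sets $\{j,j'\}$ that are canonical join representations of $j\vee j'$. -}

module Defs where

open import Data.Nat using (ℕ)
open import Data.Fin using (Fin)
open import Data.Bool using (Bool; true; false)
import Data.Bool as B
open import Data.Product using (Σ; _×_; _,_; proj₁; proj₂)
open import Data.Sum using (_⊎_; inj₁; inj₂)
open import Data.Empty using (⊥)
open import Relation.Nullary using (¬_)
open import Relation.Binary.Structures using (IsEquivalence)
open import Relation.Binary.Lattice.Structures using (IsLattice)
open import Relation.Binary.PropositionalEquality as P using (_≡_)

module Order {A : Set} (_≈_ : A → A → Set) (isEq : IsEquivalence _≈_)
             (_≤_ : A → A → Set) where
  private module E = IsEquivalence isEq

  record Subset : Set₁ where
    field
      mem  : A → Set
      resp : ∀ {x y} → x ≈ y → mem x → mem y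
  open Subset public

  ∅ : Subset
  ∅ = record { mem = λ _ → ⊥ ; resp = λ _ () }

  pair : A → A → Subset
  pair x y = record
    { mem  = λ z → z ≈ x ⊎ z ≈ y
    ; resp = λ { e (inj₁ h) → inj₁ (E.trans (E.sym e) h)
               ; e (inj₂ h) → inj₂ (E.trans (E.sym e) h) } }

  _⊆_ : Subset → Subset → Set
  S ⊆ T = ∀ x → mem S x → mem T x

  _⊂_ : Subset → Subset → Set
  S ⊂ T = S ⊆ T × Σ A (λ x → mem T x × ¬ mem S x)

  UpperBound : Subset → A → Set
  UpperBound S u = ∀ x → mem S x → x ≤ u

  IsJoinOf : Subset → A → Set
  IsJoinOf S w = UpperBound S w × (∀ u → UpperBound S u → w ≤ u)

  IsJoin₂ : A → A → A → Set
  IsJoin₂ x y w = x ≤ w × y ≤ w × (∀ u → x ≤ u → y ≤ u → w ≤ u)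

  IsMeet₂ : A → A → A → Set
  IsMeet₂ x y m = m ≤ x × m ≤ y × (∀ u → u ≤ x → u ≤ y → u ≤ m)

  JoinSemidistributive : Set
  JoinSemidistributive = ∀ x y z u m v →
    IsJoin₂ x y u → IsJoin₂ x z u → IsMeet₂ y z m → IsJoin₂ x m v → v ≈ u

  MeetSemidistributive : Set
  MeetSemidistributive = ∀ x y z u m v →
    IsMeet₂ x y u → IsMeet₂ x z u → IsJoin₂ y z m → IsMeet₂ x m v → v ≈ u

  Semidistributive : Set
  Semidistributive = JoinSemidistributive × MeetSemidistributive

  IrredundantJoin : Subset → A → Set₁
  IrredundantJoin S w = IsJoinOf S w × (∀ T → T ⊂ S → ¬ IsJoinOf T w)

  Refines : Subset → Subset → Set
  Refines S T = ∀ x → mem S x → Σ A (λ y → mem T y × x ≤ y)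

  IsCanonicalJoinRep : Subset → A → Set₁
  IsCanonicalJoinRep S w =
    IrredundantJoin S w × (∀ T → IrredundantJoin T w → Refines S T)

  InCanonical : A → A → Set₁
  InCanonical j w = Σ Subset (λ S → IsCanonicalJoinRep S w × mem S j)

  JoinIrreducible : A → Set
  JoinIrreducible j =
    ¬ IsJoinOf ∅ j × (∀ x y → IsJoin₂ x y j → j ≈ x ⊎ j ≈ y)

  CanonicalJoinGraphEdge : A → A → Set₁
  CanonicalJoinGraphEdge j j' =
    JoinIrreducible j × JoinIrreducible j' × ¬ (j ≈ j') ×
    Σ A (λ w → IsJoin₂ j j' w × IsCanonicalJoinRep (pair j j') w)

record FinLattice : Set₁ where
  field
    n         : ℕ
    _≤_       : Fin n → Fin n → Set
    _∨_       : Fin n → Fin n → Fin n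
    _∧_       : Fin n → Fin n → Fin n
    isLattice : IsLattice _≡_ _≤_ _∨_ _∧_

  Carrier : Set
  Carrier = Fin n

module _ (L : FinLattice) where
  open FinLattice L
  private module OL = Order {Fin n} _≡_ P.isEquivalence _≤_

  Semidistributive : Set
  Semidistributive = OL.Semidistributive

  Edge : Fin n → Fin n → Set₁
  Edge = OL.CanonicalJoinGraphEdge

  InCan : Fin n → Fin n → Set₁
  InCan = OL.InCanonical

module Doubling (L : FinLattice) (a b : FinLattice.Carrier L) where
  open FinLattice L

  InI : Fin n → Set
  InI x = a ≤ x × x ≤ b

  InX : Fin n → Set
  InX x = Σ (Fin n) (λ i → InI i × i ≤ x)

  InD : Fin n × Bool → Set
  InD (x , false) = ¬ InX x ⊎ InI x
  InD (x , true)  = InX x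

  Elt : Set
  Elt = Σ (Fin n × Bool) InD

  _≈D_ : Elt → Elt → Set
  p ≈D q = proj₁ p ≡ proj₁ q

  ≈D-isEquivalence : IsEquivalence _≈D_
  ≈D-isEquivalence = record { refl = P.refl ; sym = P.sym ; trans = P.trans }

  _≤D_ : Elt → Elt → Set
  p ≤D q = (proj₁ (proj₁ p) ≤ proj₁ (proj₁ q)) × (proj₂ (proj₁ p) B.≤ proj₂ (proj₁ q))

  π : Elt → Fin n
  π p = proj₁ (proj₁ p)

  module OD = Order _≈D_ ≈D-isEquivalence _≤D_

  FiberMin : Elt → Fin n → Set
  FiberMin p j = π p ≡ j × (∀ q → π q ≡ j → p ≤D q)

  E′ : Elt → Elt → Set₁
  E′ p q = Σ (Fin n) λ j → Σ (Fin n) λ j' →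
             Edge L j j' × FiberMin p j × FiberMin q j'

  NewEdgeFor : Fin n → Set₁
  NewEdgeFor j = Σ (Fin n) (λ w → InI w × InCan L j w) × ¬ (j ≤ a)

  NewEdge : Elt → Elt → Set₁
  NewEdge p q = Σ (Fin n) λ j → NewEdgeFor j ×
    ((proj₁ p ≡ (j , false) × proj₁ q ≡ (a , true)) ⊎
     (proj₁ q ≡ (j , false) × proj₁ p ≡ (a , true)))

DoubledSemidistributive : (L : FinLattice) (a b : FinLattice.Carrier L) → Set
DoubledSemidistributive L a b = Doubling.OD.Semidistributive L a b

DElt : (L : FinLattice) (a b : FinLattice.Carrier L) → Set
DElt = Doubling.Elt

DEdge : (L : FinLattice) (a b : FinLattice.Carrier L) → DElt L a b → DElt L a b → Set₁
DEdge L a b = Doubling.OD.CanonicalJoinGraphEdge L a b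

E′ : (L : FinLattice) (a b : FinLattice.Carrier L) → DElt L a b → DElt L a b → Set₁
E′ = Doubling.E′

NewEdge : (L : FinLattice) (a b : FinLattice.Carrier L) → DElt L a b → DElt L a b → Set₁
NewEdge = Doubling.NewEdge

-- The projection π : L[I] → L has both adjoints, x ↦ ⌊ x ⌋ and x ↦ ⌈ x ⌉, the least and
-- greatest elements of the fibre over x. So π preserves joins and meets, and the
-- semidistributive laws of L[I] follow from those of L once the second coordinates are
-- compared by a case analysis.
--
-- In a finite join-semidistributive lattice, can(w) is the set of maximal elements among
-- the j ≤ w that lie below a member of every join representation of w: they join to w
-- because every lower cover of w is avoided by one of them. The join-irreducibles of L[I]
-- are the fibre minima over join-irreducibles of L together with (a , 1), and the
-- refinement condition transfers along ⌊_⌋ and π. A pair {(j , 0) , (a , 1)} joins to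
-- (j ∨ a , 1): an edge makes j maximal as above for j ∨ a ∈ I, and conversely a canonical
-- joinand j of w₀ ∈ I lies below a member of every join representation of j ∨ a ≤ w₀.

module Submission where

open import Defs
open import Axiom.ExcludedMiddle using (ExcludedMiddle)
open import Algebra.Core using (Op₂)
open import Data.Bool using (Bool; true; false; f≤t; b≤b) renaming (_≤_ to _≤ᵇ_)
import Data.Bool.Properties as Bool
open import Data.Fin using (Fin)
open import Data.Fin.Properties using (_≟_)
open import Data.Nat using (zero; suc) renaming (_≤_ to _≤ℕ_)
open import Data.Nat.Properties using (≤-pred; <-≤-trans) renaming (≤-refl to ≤ℕ-refl)
open import Data.List using (List; []; _∷_; _++_; filter; foldr; length; map; allFin)
open import Data.List.Properties using (filter-notAll)
open import Data.List.Membership.Propositional using (_∈_; find; lose)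
open import Data.List.Membership.Propositional.Properties
  using (∈-filter⁺; ∈-filter⁻; ∈-++⁺ˡ; ∈-++⁺ʳ; ∈-map⁺; ∈-allFin)
open import Data.List.Relation.Unary.Any using (here; there; any?)
open import Data.Product using (∃-syntax; _×_; _,_; proj₁; proj₂)
open import Data.Product.Properties using (×-≡,≡→≡)
open import Data.Sum using (_⊎_; inj₁; inj₂)
open import Data.Empty using (⊥-elim)
open import Function using (_∘_)
open import Function.Bundles using (_⇔_; mk⇔)
open import Level using (0ℓ)
open import Relation.Nullary using (¬_; Dec; yes; no; ¬?; contradiction)
open import Relation.Nullary.Decidable using (_×-dec_; _⊎-dec_; map′)
open import Relation.Binary.Core using (Rel)
open import Relation.Binary.Definitions using (Decidable; Minimum)
open import Relation.Binary.Lattice.Definitions using (Supremum; Infimum)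
open import Relation.Binary.Structures using (IsPartialOrder)
open import Relation.Binary.Lattice.Structures using (IsLattice; IsBoundedJoinSemilattice)
open import Relation.Binary.PropositionalEquality as ≡ using (_≡_; refl)

module FiniteJoinSemilattice
  {A : Set} {_≈_ _≤_ : Rel A 0ℓ} {_∨_ : Op₂ A} {⊥ : A}
  (isBoundedJoinSemilattice : IsBoundedJoinSemilattice _≈_ _≤_ _∨_ ⊥)
  (_≈?_ : Decidable _≈_) (_≤?_ : Decidable _≤_)
  (elements : List A) (elements-complete : ∀ x → ∃[ y ] y ∈ elements × x ≈ y)
  where

  open IsBoundedJoinSemilattice isBoundedJoinSemilattice
    renaming (refl to ≤-refl; reflexive to ≤-reflexive; trans to ≤-trans; antisym to ≤-antisym)
  open Order _≈_ isEquivalence _≤_ public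

  private variable
    c j j′ p q s t u w w′ w₀ x y z : A
    xs : List A
    S T : Subset

  ⋁ : List A → A
  ⋁ []       = ⊥
  ⋁ (x ∷ xs) = x ∨ ⋁ xs

  ⋁-upper : x ∈ xs → x ≤ ⋁ xs
  ⋁-upper {xs = y ∷ ys} (here refl)  = x≤x∨y y (⋁ ys)
  ⋁-upper {xs = y ∷ ys} (there x∈ys) = ≤-trans (⋁-upper x∈ys) (y≤x∨y y (⋁ ys))

  ⋁-least : (∀ {x} → x ∈ xs → x ≤ u) → ⋁ xs ≤ u
  ⋁-least {xs = []}     _         = minimum _
  ⋁-least {xs = x ∷ xs} bounded = ∨-least (bounded (here refl)) (⋁-least (bounded ∘ there))

  fromList : List A → Subset
  fromList xs = record
    { mem  = λ x → ∃[ y ] y ∈ xs × x ≈ y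
    ; resp = λ { x≈x′ (y , y∈xs , x≈y) → y , y∈xs , Eq.trans (Eq.sym x≈x′) x≈y } }

  fromList-join : (∀ {y} → y ∈ xs → y ≤ w) → w ≤ ⋁ xs → IsJoinOf (fromList xs) w
  fromList-join below above =
      (λ { x (y , y∈xs , x≈y) → ≤-trans (≤-reflexive x≈y) (below y∈xs) })
    , (λ u bound → ≤-trans above (⋁-least λ y∈xs → bound _ (_ , y∈xs , Eq.refl)))

  without : A → List A → List A
  without z = filter (λ y → ¬? (y ≈? z))

  IrredundantList : A → List A → Set
  IrredundantList w xs = ∀ {z} → z ∈ xs → ¬ w ≤ ⋁ (without z xs)

  irredundant-sublist : ∀ w xs → w ≤ ⋁ xs →
    ∃[ ys ] (∀ {y} → y ∈ ys → y ∈ xs) × w ≤ ⋁ ys × IrredundantList w ys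
  irredundant-sublist w xs = go (length xs) xs ≤ℕ-refl
    where
    go : ∀ fuel xs → length xs ≤ℕ fuel → w ≤ ⋁ xs →
         ∃[ ys ] (∀ {y} → y ∈ ys → y ∈ xs) × w ≤ ⋁ ys × IrredundantList w ys
    go fuel xs _ w≤ with any? (λ z → w ≤? ⋁ (without z xs)) xs
    ... | no none = xs , (λ y∈ → y∈) , w≤ , λ z∈ w≤′ → none (lose z∈ w≤′)
    go zero [] _ _ | yes ()
    go (suc fuel) xs len w≤ | yes some with find some
    ... | z , z∈xs , w≤′ with go fuel (without z xs) shorter w≤′
      where
      shorter : length (without z xs) ≤ℕ fuel
      shorter = ≤-pred (<-≤-trans (filter-notAll _ xs (lose z∈xs λ z≉z → z≉z Eq.refl)) len)
    ... | ys , ys⊆ , w≤ys , irr = ys , proj₁ ∘ ∈-filter⁻ _ ∘ ys⊆ , w≤ys , irr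

  irredundant-fromList : (∀ {y} → y ∈ xs → y ≤ w) → w ≤ ⋁ xs → IrredundantList w xs →
                         IrredundantJoin (fromList xs) w
  irredundant-fromList {xs} {w} below above irr =
    fromList-join below above , λ { T (T⊆ , z , (z′ , z′∈xs , z≈z′) , z∉T) (_ , least) →
      irr z′∈xs (least (⋁ (without z′ xs)) λ x x∈T → bound {T} T⊆ z≈z′ z∉T x x∈T (T⊆ x x∈T)) }
    where
    bound : ∀ {T z z′} → T ⊆ fromList xs → z ≈ z′ → ¬ mem T z → ∀ x → mem T x →
            mem (fromList xs) x → x ≤ ⋁ (without z′ xs)
    bound {T} {z′ = z′} _ z≈z′ z∉T x x∈T (y , y∈xs , x≈y) with y ≈? z′
    ... | yes y≈z′ = contradiction (resp T (Eq.trans x≈y (Eq.trans y≈z′ (Eq.sym z≈z′))) x∈T) z∉T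
    ... | no  y≉z′ = ≤-trans (≤-reflexive x≈y) (⋁-upper (∈-filter⁺ _ y∈xs y≉z′))

  irredundant-subrep : (∀ {y} → y ∈ xs → y ≤ w) → w ≤ ⋁ xs →
    ∃[ ys ] (∀ {y} → y ∈ ys → y ∈ xs) × IrredundantJoin (fromList ys) w
  irredundant-subrep {xs} {w} below above with irredundant-sublist w xs above
  ... | ys , ys⊆xs , above′ , irr = ys , ys⊆xs , irredundant-fromList (below ∘ ys⊆xs) above′ irr

  IsJoin₂-sym : IsJoin₂ x y w → IsJoin₂ y x w
  IsJoin₂-sym (x≤w , y≤w , least) = y≤w , x≤w , λ u y≤u x≤u → least u x≤u y≤u

  IsJoinOf-resp : w ≈ w′ → IsJoinOf T w → IsJoinOf T w′
  IsJoinOf-resp w≈w′ (ub , least) =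
    (λ x x∈T → ≤-trans (ub x x∈T) (≤-reflexive w≈w′)) ,
    (λ u bound → ≤-trans (≤-reflexive (Eq.sym w≈w′)) (least u bound))

  _∖_ : Subset → A → Subset
  S ∖ j = record
    { mem  = λ x → mem S x × ¬ x ≈ j
    ; resp = λ x≈y (x∈S , x≉j) → resp S x≈y x∈S , λ y≈j → x≉j (Eq.trans x≈y y≈j) }

  ∖-bound : UpperBound (S ∖ j) u → j ≤ u → UpperBound S u
  ∖-bound {j = j} bound j≤u x x∈S with x ≈? j
  ... | yes x≈j = ≤-trans (≤-reflexive x≈j) j≤u
  ... | no  x≉j = bound x (x∈S , x≉j)

  irredundant-needs : IrredundantJoin S w → mem S j → ¬ (∀ u → UpperBound (S ∖ j) u → j ≤ u)
  irredundant-needs {S} {w} {j} ((ub , least) , irr) j∈S j≤ =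
    irr (S ∖ j) ((λ _ → proj₁) , j , j∈S , λ (_ , j≉j) → j≉j Eq.refl)
        ((λ x → ub x ∘ proj₁) , λ u bound → least u (∖-bound {S = S} bound (j≤ u bound)))

  irredundant-antichain : IrredundantJoin S w → mem S j → mem S s → j ≤ s → j ≈ s
  irredundant-antichain {S} {j = j} {s} irrS j∈S s∈S j≤s with j ≈? s
  ... | yes j≈s = j≈s
  ... | no  j≉s = contradiction (λ u bound → ≤-trans j≤s (bound s (s∈S , j≉s ∘ Eq.sym)))
                                (irredundant-needs {S = S} irrS j∈S)

  -- Canonical join representations

  RefinesJoinReps : A → A → Set₁
  RefinesJoinReps j w = ∀ T → IsJoinOf T w → ∃[ t ] mem T t × j ≤ t

  refinesJoinReps-resp : ∀ {j w w′} → w ≈ w′ → RefinesJoinReps j w → RefinesJoinReps j w′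
  refinesJoinReps-resp w≈w′ refines T join = refines T (IsJoinOf-resp {T = T} (Eq.sym w≈w′) join)

  avoiding : A → A → List A
  avoiding j w = filter (λ t → (t ≤? w) ×-dec ¬? (j ≤? t)) elements

  avoiding-below : t ∈ avoiding j w → t ≤ w × ¬ j ≤ t
  avoiding-below = proj₂ ∘ ∈-filter⁻ _ {xs = elements}

  ≤⋁avoiding : t ≤ w → ¬ j ≤ t → t ≤ ⋁ (avoiding j w)
  ≤⋁avoiding {t} t≤w j≰t with elements-complete t
  ... | e , e∈ , t≈e = ≤-trans (≤-reflexive t≈e) (⋁-upper (∈-filter⁺ _ e∈
      (≤-trans (≤-reflexive (Eq.sym t≈e)) t≤w , λ j≤e → j≰t (≤-trans j≤e (≤-reflexive (Eq.sym t≈e))))))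

  avoiding-mono : j′ ≤ j → w ≤ w′ → ⋁ (avoiding j′ w) ≤ ⋁ (avoiding j w′)
  avoiding-mono j′≤j w≤w′ = ⋁-least λ t∈ → let t≤w , j′≰t = avoiding-below t∈ in
    ≤⋁avoiding (≤-trans t≤w w≤w′) (λ j≤t → j′≰t (≤-trans j′≤j j≤t))

  -- A decidable stand-in for RefinesJoinReps j w (equivalent to it under excluded middle):
  -- w is not the join of the elements below it that avoid j.
  Essential : A → A → Set
  Essential j w = ¬ w ≤ ⋁ (avoiding j w)

  essential? : Decidable Essential
  essential? j w = ¬? (w ≤? ⋁ (avoiding j w))

  essential-anti : j′ ≤ j → Essential j w → Essential j′ w
  essential-anti j′≤j ess w≤ = ess (≤-trans w≤ (avoiding-mono j′≤j ≤-refl))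

  refinesJoinReps⇒essential : RefinesJoinReps j w → Essential j w
  refinesJoinReps⇒essential {j} {w} refines w≤
    with refines (fromList (avoiding j w)) (fromList-join (proj₁ ∘ avoiding-below) w≤)
  ... | t , (y , y∈ , t≈y) , j≤t = proj₂ (avoiding-below y∈) (≤-trans j≤t (≤-reflexive t≈y))

  essential⇒refinesJoinReps : ExcludedMiddle 0ℓ → Essential j w → RefinesJoinReps j w
  essential⇒refinesJoinReps {j} em ess T (ub , least) with em {∃[ t ] mem T t × j ≤ t}
  ... | yes found = found
  ... | no  none  = contradiction
    (least _ λ t t∈T → ≤⋁avoiding (ub t t∈T) λ j≤t → none (t , t∈T , j≤t)) ess

  -- Otherwise w is the join of the elements below it avoiding j (the other members of S
  -- avoid j); S refines an irredundant subfamily of these, so one of them lies above j.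
  canonical-¬≤avoiding : IsCanonicalJoinRep S w → mem S j → ¬ j ≤ ⋁ (avoiding j w)
  canonical-¬≤avoiding {S} {w} {j} (irrS@((ub , least) , _) , refines) j∈S j≤
    with irredundant-subrep (proj₁ ∘ avoiding-below) w≤
    where
    w≤ : w ≤ ⋁ (avoiding j w)
    w≤ = least _ (∖-bound {S = S} (λ s (s∈S , s≉j) → ≤⋁avoiding (ub s s∈S)
           λ j≤s → s≉j (Eq.sym (irredundant-antichain {S = S} irrS j∈S s∈S j≤s))) j≤)
  ... | ys , ys⊆ , irrYs with refines (fromList ys) irrYs j j∈S
  ... | t , (y , y∈ys , t≈y) , j≤t =
    proj₂ (avoiding-below (ys⊆ y∈ys)) (≤-trans j≤t (≤-reflexive t≈y))

  canonical⇒essential : IsCanonicalJoinRep S w₀ → mem S j → j ≤ w → w ≤ w₀ → Essential j w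
  canonical⇒essential {S} can j∈S j≤w w≤w₀ w≤ =
    canonical-¬≤avoiding {S} can j∈S (≤-trans j≤w (≤-trans w≤ (avoiding-mono ≤-refl w≤w₀)))

  canonical⇒joinIrreducible : IsCanonicalJoinRep S w → mem S j → JoinIrreducible j
  canonical⇒joinIrreducible {S} {w} {j} can@(((ub , _) , _) , _) j∈S = nonBottom , binary
    where
    j≤w : j ≤ w
    j≤w = ub j j∈S
    j≰⋁ : ¬ j ≤ ⋁ (avoiding j w)
    j≰⋁ = canonical-¬≤avoiding {S} can j∈S
    nonBottom : ¬ IsJoinOf ∅ j
    nonBottom (_ , least) = j≰⋁ (least _ λ _ ())
    binary : ∀ x y → IsJoin₂ x y j → j ≈ x ⊎ j ≈ y
    binary x y (x≤j , y≤j , least) with j ≤? x | j ≤? y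
    ... | yes j≤x | _       = inj₁ (≤-antisym j≤x x≤j)
    ... | no  _   | yes j≤y = inj₂ (≤-antisym j≤y y≤j)
    ... | no  j≰x | no  j≰y = contradiction
      (least _ (≤⋁avoiding (≤-trans x≤j j≤w) j≰x) (≤⋁avoiding (≤-trans y≤j j≤w) j≰y)) j≰⋁

  -- Subsets are arbitrary predicates, so a canonical join representation carries
  -- classical content: refining the representation {w | Q} ∪ {S | ¬ Q} decides Q.
  canonical⇒excludedMiddle : IsCanonicalJoinRep S w → mem S j → ExcludedMiddle 0ℓ
  canonical⇒excludedMiddle {S} {w} {j} (((ubS , leastS) , irrS) , refines) j∈S {Q}
    with refines Tq (join , irredundant) j j∈S
    where
    Tq : Subset
    Tq = record
      { mem  = λ x → (x ≈ w × Q) ⊎ (mem S x × ¬ Q)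
      ; resp = λ { x≈y (inj₁ (x≈w , q)) → inj₁ (Eq.trans (Eq.sym x≈y) x≈w , q)
                 ; x≈y (inj₂ (x∈S , ¬q)) → inj₂ (resp S x≈y x∈S , ¬q) } }
    join : IsJoinOf Tq w
    join = (λ { x (inj₁ (x≈w , _)) → ≤-reflexive x≈w ; x (inj₂ (x∈S , _)) → ubS x x∈S }) , least
      where
      least : ∀ u → UpperBound Tq u → w ≤ u
      least u bound with w ≤? u
      ... | yes w≤u = w≤u
      ... | no  w≰u = contradiction (leastS u λ x x∈S → bound x (inj₂ (x∈S , ¬q))) w≰u
        where
        ¬q : ¬ Q
        ¬q q = w≰u (bound w (inj₁ (Eq.refl , q)))
    irredundant : ∀ T′ → T′ ⊂ Tq → ¬ IsJoinOf T′ w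
    irredundant T′ (T′⊆Tq , z , inj₁ (z≈w , q) , z∉T′) (_ , least) =
      irrS ∅ ((λ _ ()) , j , j∈S , λ ()) ((λ _ ()) , λ u _ → least u λ x x∈T′ → absurd x x∈T′ (T′⊆Tq x x∈T′))
      where
      absurd : ∀ {u} x → mem T′ x → mem Tq x → x ≤ u
      absurd x x∈T′ (inj₁ (x≈w , _)) = contradiction (resp T′ (Eq.trans x≈w (Eq.sym z≈w)) x∈T′) z∉T′
      absurd x x∈T′ (inj₂ (_ , ¬q))  = contradiction q ¬q
    irredundant T′ (T′⊆Tq , z , inj₂ (z∈S , ¬q) , z∉T′) =
      irrS T′ ((λ x x∈T′ → inS x (T′⊆Tq x x∈T′)) , z , z∈S , z∉T′)
      where
      inS : ∀ x → mem Tq x → mem S x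
      inS x (inj₁ (_ , q))  = contradiction q ¬q
      inS x (inj₂ (x∈S , _)) = x∈S
  ... | _ , inj₁ (_ , q)  , _ = yes q
  ... | _ , inj₂ (_ , ¬q) , _ = no ¬q

  canonical⇒refinesJoinReps : ExcludedMiddle 0ℓ → IsCanonicalJoinRep S w₀ → mem S j →
                              j ≤ w → w ≤ w₀ → RefinesJoinReps j w
  canonical⇒refinesJoinReps {S} em can j∈S j≤w w≤w₀ =
    essential⇒refinesJoinReps em (canonical⇒essential {S} can j∈S j≤w w≤w₀)

  pair-join : ∀ {p q w} → IsJoin₂ p q w → IsJoinOf (pair p q) w
  pair-join (p≤w , q≤w , least) =
    (λ { x (inj₁ x≈p) → ≤-trans (≤-reflexive x≈p) p≤w ; x (inj₂ x≈q) → ≤-trans (≤-reflexive x≈q) q≤w }) ,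
    λ u bound → least u (bound _ (inj₁ Eq.refl)) (bound _ (inj₂ Eq.refl))

  single : A → Subset
  single p = record { mem = _≈ p ; resp = λ x≈y x≈p → Eq.trans (Eq.sym x≈y) x≈p }

  _∪_ : Subset → Subset → Subset
  S ∪ T = record
    { mem  = λ x → mem S x ⊎ mem T x
    ; resp = λ { x≈y (inj₁ x∈S) → inj₁ (resp S x≈y x∈S) ; x≈y (inj₂ x∈T) → inj₂ (resp T x≈y x∈T) } }

  irredundant-pair : IrredundantJoin (pair p q) w → ¬ p ≈ q → ¬ w ≤ p × ¬ w ≤ q
  irredundant-pair {p} {q} {w} ((ub , _) , irr) p≉q =
      (λ w≤p → irr (single p) ((λ _ → inj₁) , q , inj₂ Eq.refl , p≉q ∘ Eq.sym) (alone p (inj₁ Eq.refl) w≤p))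
    , (λ w≤q → irr (single q) ((λ _ → inj₂) , p , inj₁ Eq.refl , p≉q) (alone q (inj₂ Eq.refl) w≤q))
    where
    alone : ∀ x → mem (pair p q) x → w ≤ x → IsJoinOf (single x) w
    alone x x∈ w≤x =
      (λ y y≈x → ≤-trans (≤-reflexive y≈x) (ub x x∈)) , λ u bound → ≤-trans w≤x (bound x Eq.refl)

  pair-canonical : IsJoin₂ p q w → ¬ w ≤ p → ¬ w ≤ q → RefinesJoinReps p w → RefinesJoinReps q w →
                   IsCanonicalJoinRep (pair p q) w
  pair-canonical {p} {q} {w} join w≰p w≰q p-refines q-refines = (pair-join join , irredundant) , refines
    where
    irredundant : ∀ T → T ⊂ pair p q → ¬ IsJoinOf T w
    irredundant T (T⊆ , z , inj₁ z≈p , z∉T) (_ , least) = w≰q (least q only-q)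
      where
      only-q : UpperBound T q
      only-q x x∈T with T⊆ x x∈T
      ... | inj₁ x≈p = contradiction (resp T (Eq.trans x≈p (Eq.sym z≈p)) x∈T) z∉T
      ... | inj₂ x≈q = ≤-reflexive x≈q
    irredundant T (T⊆ , z , inj₂ z≈q , z∉T) (_ , least) = w≰p (least p only-p)
      where
      only-p : UpperBound T p
      only-p x x∈T with T⊆ x x∈T
      ... | inj₁ x≈p = ≤-reflexive x≈p
      ... | inj₂ x≈q = contradiction (resp T (Eq.trans x≈q (Eq.sym z≈q)) x∈T) z∉T
    refines : ∀ T → IrredundantJoin T w → Refines (pair p q) T
    refines T (join , _) x (inj₁ x≈p) with p-refines T join
    ... | t , t∈T , p≤t = t , t∈T , ≤-trans (≤-reflexive x≈p) p≤t
    refines T (join , _) x (inj₂ x≈q) with q-refines T join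
    ... | t , t∈T , q≤t = t , t∈T , ≤-trans (≤-reflexive x≈q) q≤t

  -- A canonical join graph edge, with canonicity of {p , q} replaced by conditions on
  -- p, q and their join.
  record EdgeData (p q : A) : Set₁ where
    field
      p-irreducible : JoinIrreducible p
      q-irreducible : JoinIrreducible q
      p≉q           : ¬ p ≈ q
      top           : A
      isJoin        : IsJoin₂ p q top
      top≰p         : ¬ top ≤ p
      top≰q         : ¬ top ≤ q
      p-refines     : RefinesJoinReps p top
      q-refines     : RefinesJoinReps q top

  edge⇒excludedMiddle : CanonicalJoinGraphEdge p q → ExcludedMiddle 0ℓ
  edge⇒excludedMiddle {p} {q} (_ , _ , _ , _ , _ , can) =
    canonical⇒excludedMiddle {pair p q} can (inj₁ Eq.refl)

  edge⇒edgeData : CanonicalJoinGraphEdge p q → EdgeData p q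
  edge⇒edgeData {p} {q} edge@(p-irr , q-irr , p≉q , w , join , can) = record
    { p-irreducible = p-irr
    ; q-irreducible = q-irr
    ; p≉q           = p≉q
    ; top           = w
    ; isJoin        = join
    ; top≰p         = proj₁ (irredundant-pair (proj₁ can) p≉q)
    ; top≰q         = proj₂ (irredundant-pair (proj₁ can) p≉q)
    ; p-refines     = canonical⇒refinesJoinReps {pair p q} em can (inj₁ Eq.refl) p≤w ≤-refl
    ; q-refines     = canonical⇒refinesJoinReps {pair p q} em can (inj₂ Eq.refl) q≤w ≤-refl
    }
    where
    em : ExcludedMiddle 0ℓ
    em = edge⇒excludedMiddle {p} {q} edge
    p≤w : p ≤ w
    p≤w = proj₁ join
    q≤w : q ≤ w
    q≤w = proj₁ (proj₂ join)

  edgeData⇒edge : EdgeData p q → CanonicalJoinGraphEdge p q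
  edgeData⇒edge e = p-irreducible , q-irreducible , p≉q , top , isJoin ,
                    pair-canonical isJoin top≰p top≰q p-refines q-refines
    where open EdgeData e

  edgeData-swap : EdgeData p q → EdgeData q p
  edgeData-swap e = record
    { p-irreducible = q-irreducible
    ; q-irreducible = p-irreducible
    ; p≉q           = p≉q ∘ Eq.sym
    ; top           = top
    ; isJoin        = IsJoin₂-sym isJoin
    ; top≰p         = top≰q
    ; top≰q         = top≰p
    ; p-refines     = q-refines
    ; q-refines     = p-refines
    }
    where open EdgeData e

  module _ {P : A → Set} (P? : ∀ x → Dec (P x)) where

    climb : A → List A → A
    climb c []       = c
    climb c (y ∷ ys) with P? y ×-dec (c ≤? y)
    ... | yes _ = climb y ys
    ... | no  _ = climb c ys

    climb-P : ∀ {c} xs → P c → P (climb c xs)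
    climb-P []           Pc = Pc
    climb-P {c} (y ∷ ys) Pc with P? y ×-dec (c ≤? y)
    ... | yes (Py , _) = climb-P ys Py
    ... | no  _        = climb-P ys Pc

    climb-≥ : ∀ c xs → c ≤ climb c xs
    climb-≥ c []       = ≤-refl
    climb-≥ c (y ∷ ys) with P? y ×-dec (c ≤? y)
    ... | yes (_ , c≤y) = ≤-trans c≤y (climb-≥ y ys)
    ... | no  _         = climb-≥ c ys

    climb-maximal : ∀ c xs → y ∈ xs → P y → climb c xs ≤ y → y ≤ climb c xs
    climb-maximal c (x ∷ xs) y∈ Py c′≤y with P? x ×-dec (c ≤? x)
    climb-maximal c (x ∷ xs) (here refl) _  _    | yes _     = climb-≥ x xs
    climb-maximal c (x ∷ xs) (here refl) Py c′≤y | no  ¬step =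
      contradiction (Py , ≤-trans (climb-≥ c xs) c′≤y) ¬step
    climb-maximal c (x ∷ xs) (there y∈)  Py c′≤y | yes _     = climb-maximal x xs y∈ Py c′≤y
    climb-maximal c (x ∷ xs) (there y∈)  Py c′≤y | no  _     = climb-maximal c xs y∈ Py c′≤y

    exists-maximal-above : (∀ {x y} → x ≈ y → P x → P y) → P x →
      ∃[ c ] P c × x ≤ c × (∀ y → P y → c ≤ y → y ≈ c)
    exists-maximal-above {x} respP Px = climb x elements , climb-P elements Px , climb-≥ x elements , maximal
      where
      maximal : ∀ y → P y → climb x elements ≤ y → y ≈ climb x elements
      maximal y Py c≤y with elements-complete y
      ... | e , e∈ , y≈e = ≤-antisym
        (≤-trans (≤-reflexive y≈e)
                 (climb-maximal x elements e∈ (respP y≈e Py) (≤-trans c≤y (≤-reflexive y≈e))))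
        c≤y

  module CanonicalJoinRepresentations
    {_∧_ : Op₂ A} (∧-infimum : Infimum _≤_ _∧_)
    (joinSemidistributive : JoinSemidistributive) (em : ExcludedMiddle 0ℓ) where

    x∧y≤x : ∀ x y → (x ∧ y) ≤ x
    x∧y≤x x y = proj₁ (∧-infimum x y)

    x∧y≤y : ∀ x y → (x ∧ y) ≤ y
    x∧y≤y x y = proj₁ (proj₂ (∧-infimum x y))

    ∧-greatest : u ≤ x → u ≤ y → u ≤ (x ∧ y)
    ∧-greatest {u} {x} {y} = proj₂ (proj₂ (∧-infimum x y)) u

    _⋖_ : A → A → Set
    c ⋖ w = c ≤ w × ¬ w ≤ c × (∀ x → c ≤ x → x ≤ w → ¬ w ≤ x → x ≈ c)

    lowerCover-above : u ≤ w → ¬ w ≤ u → ∃[ c ] u ≤ c × c ⋖ w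
    lowerCover-above {u} {w} u≤w w≰u
      with exists-maximal-above (λ x → (x ≤? w) ×-dec ¬? (w ≤? x)) below-not-above (u≤w , w≰u)
      where
      below-not-above : ∀ {x y} → x ≈ y → x ≤ w × ¬ w ≤ x → y ≤ w × ¬ w ≤ y
      below-not-above x≈y (x≤w , w≰x) =
        ≤-trans (≤-reflexive (Eq.sym x≈y)) x≤w , λ w≤y → w≰x (≤-trans w≤y (≤-reflexive (Eq.sym x≈y)))
    ... | c , (c≤w , w≰c) , u≤c , maximal =
      c , u≤c , c≤w , w≰c , λ x c≤x x≤w w≰x → maximal x (x≤w , w≰x) c≤x

    lowerCover-join : c ⋖ w → t ≤ w → ¬ t ≤ c → IsJoin₂ c t w
    lowerCover-join {c} {w} {t} (c≤w , _ , maximal) t≤w t≰c =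
      c≤w , t≤w , λ u c≤u t≤u → ≤-trans w≤c∨t (∨-least c≤u t≤u)
      where
      w≤c∨t : w ≤ (c ∨ t)
      w≤c∨t with w ≤? (c ∨ t)
      ... | yes w≤ = w≤
      ... | no  w≰ = contradiction
        (≤-trans (y≤x∨y c t) (≤-reflexive (maximal _ (x≤x∨y c t) (∨-least c≤w t≤w) w≰))) t≰c

    ⋀ : A → List A → A
    ⋀ w []       = w
    ⋀ w (t ∷ ts) = t ∧ ⋀ w ts

    ⋀-lower : t ∈ xs → ⋀ w xs ≤ t
    ⋀-lower {xs = x ∷ xs} {w} (here refl) = x∧y≤x x (⋀ w xs)
    ⋀-lower {xs = x ∷ xs} {w} (there t∈) = ≤-trans (x∧y≤y x (⋀ w xs)) (⋀-lower t∈)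

    ⋀-closed : {P : A → Set} → (∀ {x y} → P x → P y → P (x ∧ y)) →
               P w → (∀ {t} → t ∈ xs → P t) → P (⋀ w xs)
    ⋀-closed {xs = []}     _      Pw _   = Pw
    ⋀-closed {xs = x ∷ xs} closed Pw Pxs = closed (Pxs (here refl)) (⋀-closed closed Pw (Pxs ∘ there))

    -- This is where join-semidistributivity enters: c ∨ t = w = c ∨ x gives c ∨ (t ∧ x) = w.
    lowerCover-complement-∧ : c ⋖ w → t ≤ w × ¬ t ≤ c → x ≤ w × ¬ x ≤ c →
                              (t ∧ x) ≤ w × ¬ (t ∧ x) ≤ c
    lowerCover-complement-∧ {c} {w} {t} {x} cover@(_ , w≰c , _) (t≤w , t≰c) (x≤w , x≰c) =
      ≤-trans (x∧y≤x t x) t≤w ,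
      λ t∧x≤c → w≰c (≤-trans (≤-reflexive (Eq.sym c∨t∧x≈w)) (∨-least ≤-refl t∧x≤c))
      where
      c∨t∧x≈w : (c ∨ (t ∧ x)) ≈ w
      c∨t∧x≈w = joinSemidistributive c t x w (t ∧ x) (c ∨ (t ∧ x))
        (lowerCover-join cover t≤w t≰c) (lowerCover-join cover x≤w x≰c) (∧-infimum t x) (supremum c (t ∧ x))

    lowerCover⇒essential : c ⋖ w → ∃[ j ] j ≤ w × ¬ j ≤ c × Essential j w
    lowerCover⇒essential {c} {w} cover@(_ , w≰c , _) = j₀ , proj₁ j₀-outside , proj₂ j₀-outside , essential
      where
      outside? : ∀ t → Dec (t ≤ w × ¬ t ≤ c)
      outside? t = (t ≤? w) ×-dec ¬? (t ≤? c)
      j₀ : A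
      j₀ = ⋀ w (filter outside? elements)
      j₀-outside : j₀ ≤ w × ¬ j₀ ≤ c
      j₀-outside = ⋀-closed (lowerCover-complement-∧ cover) (≤-refl , w≰c)
                            (proj₂ ∘ ∈-filter⁻ outside? {xs = elements})
      j₀-least : ∀ {t} → t ≤ w → ¬ t ≤ c → j₀ ≤ t
      j₀-least {t} t≤w t≰c with elements-complete t
      ... | e , e∈ , t≈e = ≤-trans (⋀-lower (∈-filter⁺ outside? e∈
          (≤-trans (≤-reflexive (Eq.sym t≈e)) t≤w , λ e≤c → t≰c (≤-trans (≤-reflexive t≈e) e≤c))))
        (≤-reflexive (Eq.sym t≈e))
      avoiding-below-c : ∀ {t} → t ≤ w → ¬ j₀ ≤ t → Dec (t ≤ c) → t ≤ c
      avoiding-below-c _   _    (yes t≤c) = t≤c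
      avoiding-below-c t≤w j₀≰t (no  t≰c) = contradiction (j₀-least t≤w t≰c) j₀≰t
      essential : Essential j₀ w
      essential w≤ = w≰c (≤-trans w≤ (⋁-least λ {t} t∈ →
        let t≤w , j₀≰t = avoiding-below t∈ in avoiding-below-c t≤w j₀≰t (t ≤? c)))

    MaximalEssential : A → A → Set
    MaximalEssential w x = x ≤ w × Essential x w × (∀ y → y ≤ w → Essential y w → x ≤ y → y ≈ x)

    below-maximalEssential : x ≤ w → Essential x w → ∃[ r ] MaximalEssential w r × x ≤ r
    below-maximalEssential {x} {w} x≤w ess
      with exists-maximal-above (λ y → (y ≤? w) ×-dec essential? y w) below-essential (x≤w , ess)
      where
      below-essential : ∀ {y y′} → y ≈ y′ → y ≤ w × Essential y w → y′ ≤ w × Essential y′ w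
      below-essential y≈y′ (y≤w , ess-y) =
        ≤-trans (≤-reflexive (Eq.sym y≈y′)) y≤w , essential-anti (≤-reflexive (Eq.sym y≈y′)) ess-y
    ... | r , (r≤w , ess-r) , x≤r , maximal =
      r , (r≤w , ess-r , λ y y≤w ess-y r≤y → maximal y (y≤w , ess-y) r≤y) , x≤r

    canonicalRep : A → Subset
    canonicalRep w = record
      { mem  = MaximalEssential w
      ; resp = λ x≈y (x≤w , ess , maximal) →
          ≤-trans (≤-reflexive (Eq.sym x≈y)) x≤w , essential-anti (≤-reflexive (Eq.sym x≈y)) ess ,
          λ z z≤w ess-z y≤z → Eq.trans (maximal z z≤w ess-z (≤-trans (≤-reflexive x≈y) y≤z)) x≈y }

    -- If u ∧ w < w, some member of canonicalRep w avoids a lower cover of w above u ∧ w.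
    canonicalRep-join : IsJoinOf (canonicalRep w) w
    canonicalRep-join {w} = (λ _ → proj₁) , least
      where
      least : ∀ u → UpperBound (canonicalRep w) u → w ≤ u
      least u bound with w ≤? (u ∧ w)
      ... | yes w≤u∧w = ≤-trans w≤u∧w (x∧y≤x u w)
      ... | no  w≰u∧w with lowerCover-above (x∧y≤y u w) w≰u∧w
      ... | c , u∧w≤c , cover with lowerCover⇒essential cover
      ... | j , j≤w , j≰c , ess-j with below-maximalEssential j≤w ess-j
      ... | r , r-max@(r≤w , _) , j≤r =
        contradiction (≤-trans j≤r (≤-trans (∧-greatest (bound r r-max) r≤w) u∧w≤c)) j≰c

    canonicalRep-canonical : IsCanonicalJoinRep (canonicalRep w) w
    canonicalRep-canonical {w} = (canonicalRep-join , irredundant) , refines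
      where
      irredundant : ∀ T → T ⊂ canonicalRep w → ¬ IsJoinOf T w
      irredundant T (T⊆ , z , (_ , ess-z , maximal) , z∉T) join
        with essential⇒refinesJoinReps em ess-z T join
      ... | y , y∈T , z≤y = let y≤w , ess-y , _ = T⊆ y y∈T in
        z∉T (resp T (maximal y y≤w ess-y z≤y) y∈T)
      refines : ∀ T → IrredundantJoin T w → Refines (canonicalRep w) T
      refines T (join , _) x (_ , ess , _) = essential⇒refinesJoinReps em ess T join

    maximalEssential⇒inCanonical : MaximalEssential w j → InCanonical j w
    maximalEssential⇒inCanonical j-max = canonicalRep _ , canonicalRep-canonical , j-max


module FinLatticeStructure (L : FinLattice) where
  open FinLattice L public
  open IsLattice isLattice public
    renaming (refl to ≤-refl; reflexive to ≤-reflexive; trans to ≤-trans; antisym to ≤-antisym)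

  _≤?_ : Decidable _≤_
  x ≤? y = map′ (λ x∨y≡y → ≡.subst (x ≤_) x∨y≡y (x≤x∨y x y))
                (λ x≤y → ≤-antisym (∨-least x≤y ≤-refl) (y≤x∨y x y))
                ((x ∨ y) ≟ y)

  -- The meet of all elements; a seed element is needed because the carrier may be empty.
  bottom : Carrier → Carrier
  bottom x₀ = foldr _∧_ x₀ (allFin n)

  bottom-minimum : ∀ x₀ → Minimum _≤_ (bottom x₀)
  bottom-minimum x₀ x = below (allFin n) (∈-allFin x)
    where
    below : ∀ {x} xs → x ∈ xs → foldr _∧_ x₀ xs ≤ x
    below (y ∷ ys) (here refl) = x∧y≤x y _
    below (y ∷ ys) (there x∈)  = ≤-trans (x∧y≤y y _) (below ys x∈)

  isPartialOrder≡ : IsPartialOrder _≡_ _≤_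
  isPartialOrder≡ = record
    { isPreorder = record
      { isEquivalence = ≡.isEquivalence ; reflexive = ≤-reflexive ; trans = ≤-trans }
    ; antisym    = ≤-antisym
    }

  isBoundedJoinSemilattice : ∀ x₀ → IsBoundedJoinSemilattice _≡_ _≤_ _∨_ (bottom x₀)
  isBoundedJoinSemilattice x₀ = record
    { isJoinSemilattice = record { isPartialOrder = isPartialOrder≡ ; supremum = supremum }
    ; minimum           = bottom-minimum x₀
    }

  module AsFiniteJoinSemilattice (x₀ : Carrier) =
    FiniteJoinSemilattice (isBoundedJoinSemilattice x₀) _≟_ _≤?_ (allFin n) (λ x → x , ∈-allFin x , refl)

module DoubledLattice (L : FinLattice) (a b : FinLattice.Carrier L) (a≤b : FinLattice._≤_ L a b) where
  open FinLatticeStructure L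
  open Doubling L a b hiding (E′; NewEdge)
  module Base = AsFiniteJoinSemilattice a

  private variable
    x y : Carrier
    p q u : Elt

  level : Elt → Bool
  level p = proj₂ (proj₁ p)

  InX⇒a≤ : InX x → a ≤ x
  InX⇒a≤ (i , (a≤i , _) , i≤x) = ≤-trans a≤i i≤x

  a≤⇒InX : a ≤ x → InX x
  a≤⇒InX a≤x = a , (≤-refl , a≤b) , a≤x

  InX? : ∀ x → Dec (InX x)
  InX? x = map′ a≤⇒InX InX⇒a≤ (a ≤? x)

  InD₀? : ∀ x → Dec (InD (x , false))
  InD₀? x = ¬? (InX? x) ⊎-dec ((a ≤? x) ×-dec (x ≤? b))

  ¬InD₀⇒InX : ¬ InD (x , false) → InX x
  ¬InD₀⇒InX {x} x₀∉D with InX? x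
  ... | yes x∈X = x∈X
  ... | no  x∉X = contradiction (inj₁ x∉X) x₀∉D

  ≤b⇒InD₀ : x ≤ b → InD (x , false)
  ≤b⇒InD₀ {x} x≤b with a ≤? x
  ... | yes a≤x = inj₂ (a≤x , x≤b)
  ... | no  a≰x = inj₁ (a≰x ∘ InX⇒a≤)

  InD₀-below : a ≤ x → x ≤ y → InD (y , false) → InI x
  InD₀-below a≤x x≤y (inj₁ y∉X)        = contradiction (a≤⇒InX (≤-trans a≤x x≤y)) y∉X
  InD₀-below a≤x x≤y (inj₂ (_ , y≤b)) = a≤x , ≤-trans x≤y y≤b

  a₀ a₁ : Elt
  a₀ = (a , false) , inj₂ (≤-refl , a≤b)
  a₁ = (a , true) , a≤⇒InX ≤-refl

  ≤D-refl : ∀ {p} → p ≤D p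
  ≤D-refl = ≤-refl , Bool.≤-refl

  ≤D-reflexive : ∀ {p q} → p ≈D q → p ≤D q
  ≤D-reflexive {p} refl = ≤D-refl {p}

  ≤D-trans : ∀ {p q u} → p ≤D q → q ≤D u → p ≤D u
  ≤D-trans (x≤y , ε≤δ) (y≤z , δ≤ζ) = ≤-trans x≤y y≤z , Bool.≤-trans ε≤δ δ≤ζ

  ≤D-antisym : ∀ {p q} → p ≤D q → q ≤D p → p ≈D q
  ≤D-antisym (x≤y , ε≤δ) (y≤x , δ≤ε) = ×-≡,≡→≡ (≤-antisym x≤y y≤x , Bool.≤-antisym ε≤δ δ≤ε)

  _≤D?_ : Decidable _≤D_
  p ≤D? q = (π p ≤? π q) ×-dec (level p Bool.≤? level q)

  _≈D?_ : Decidable _≈D_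
  p ≈D? q = ×-≟ (π p) (π q) (level p) (level q)
    where
    ×-≟ : ∀ x y ε δ → Dec ((x , ε) ≡ (y , δ))
    ×-≟ x y ε δ = map′ ×-≡,≡→≡ (λ { refl → refl , refl }) ((x ≟ y) ×-dec (ε Bool.≟ δ))

  isPartialOrderD : IsPartialOrder _≈D_ _≤D_
  isPartialOrderD = record
    { isPreorder = record
      { isEquivalence = ≈D-isEquivalence
      ; reflexive     = λ {p} {q} → ≤D-reflexive {p} {q}
      ; trans         = λ {p} {q} {u} → ≤D-trans {p} {q} {u}
      }
    ; antisym = λ {p} {q} → ≤D-antisym {p} {q}
    }

  level₁⇒a≤ : level p ≡ true → a ≤ π p
  level₁⇒a≤ {(_ , true) , x∈X} refl = InX⇒a≤ x∈X

  level₀⇒InD₀ : level p ≡ false → InD (π p , false)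
  level₀⇒InD₀ {(_ , false) , x₀∈D} refl = x₀∈D

  ≤D-level₁ : ∀ {p q} → p ≤D q → level p ≡ true → level q ≡ true
  ≤D-level₁ (_ , b≤b) refl = refl

  ≤D-level₀ : ∀ {p q} → p ≤D q → level q ≡ false → level p ≡ false
  ≤D-level₀ (_ , b≤b) refl = refl

  level₀-≤D : ∀ {p q} → level p ≡ false → π p ≤ π q → p ≤D q
  level₀-≤D {q = q} refl πp≤πq = πp≤πq , Bool.≤-minimum (level q)

  level₁-≤D : ∀ {p q} → level q ≡ true → π p ≤ π q → p ≤D q
  level₁-≤D {p = p} refl πp≤πq = πp≤πq , Bool.≤-maximum (level p)

  upper≰lower : ∀ {p q} → level p ≡ true → level q ≡ false → ¬ p ≤D q
  upper≰lower refl refl (_ , ())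

  level-cases : ∀ p → level p ≡ false ⊎ level p ≡ true
  level-cases ((_ , false) , _) = inj₁ refl
  level-cases ((_ , true)  , _) = inj₂ refl

  -- The fibres of π

  ⌊_⌋ : Carrier → Elt
  ⌊ x ⌋ with InD₀? x
  ... | yes x₀∈D = (x , false) , x₀∈D
  ... | no  x₀∉D = (x , true) , ¬InD₀⇒InX x₀∉D

  ⌈_⌉ : Carrier → Elt
  ⌈ x ⌉ with InX? x
  ... | yes x∈X = (x , true) , x∈X
  ... | no  x∉X = (x , false) , inj₁ x∉X

  π-⌊⌋ : π ⌊ x ⌋ ≡ x
  π-⌊⌋ {x} with InD₀? x
  ... | yes _ = refl
  ... | no  _ = refl

  π-⌈⌉ : π ⌈ x ⌉ ≡ x
  π-⌈⌉ {x} with InX? x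
  ... | yes _ = refl
  ... | no  _ = refl

  ⌊⌋-least : ∀ p → x ≤ π p → ⌊ x ⌋ ≤D p
  ⌊⌋-least {x} p x≤p with InD₀? x
  ... | yes _    = x≤p , Bool.≤-minimum (level p)
  ... | no  x₀∉D = x≤p , upper p x≤p
    where
    upper : ∀ p → x ≤ π p → true ≤ᵇ level p
    upper ((_ , true)  , _)    _   = b≤b
    upper ((_ , false) , y₀∈D) x≤y =
      contradiction (inj₂ (InD₀-below (InX⇒a≤ (¬InD₀⇒InX x₀∉D)) x≤y y₀∈D)) x₀∉D

  ⌈⌉-greatest : ∀ p → π p ≤ x → p ≤D ⌈ x ⌉
  ⌈⌉-greatest {x} p p≤x with InX? x
  ... | yes _   = p≤x , Bool.≤-maximum (level p)
  ... | no  x∉X = p≤x , lower p p≤x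
    where
    lower : ∀ p → π p ≤ x → level p ≤ᵇ false
    lower ((_ , false) , _)   _   = b≤b
    lower ((_ , true)  , y∈X) y≤x = contradiction (a≤⇒InX (≤-trans (InX⇒a≤ y∈X) y≤x)) x∉X

  ⌊⌋≤⇒ : ⌊ x ⌋ ≤D p → x ≤ π p
  ⌊⌋≤⇒ {p = p} ⌊x⌋≤p = ≡.subst (_≤ π p) π-⌊⌋ (proj₁ ⌊x⌋≤p)

  ≤⌈⌉⇒ : p ≤D ⌈ x ⌉ → π p ≤ x
  ≤⌈⌉⇒ {p} p≤⌈x⌉ = ≡.subst (π p ≤_) π-⌈⌉ (proj₁ p≤⌈x⌉)

  fiberMin-least : ∀ {p j q} → FiberMin p j → j ≤ π q → p ≤D q
  fiberMin-least {p} {j} {q} (_ , least) j≤q = ≤D-trans {p} {⌊ j ⌋} {q} (least ⌊ j ⌋ π-⌊⌋) (⌊⌋-least q j≤q)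

  fiberMin-≤ : ∀ {p j q} → FiberMin p j → p ≤D q → j ≤ π q
  fiberMin-≤ {q = q} (πp≡j , _) p≤q = ≡.subst (_≤ π q) πp≡j (proj₁ p≤q)

  fiberMin-level₀ : level p ≡ false → FiberMin p (π p)
  fiberMin-level₀ {p} p₀ = refl , λ q πq≡πp → level₀-≤D {p} {q} p₀ (≤-reflexive (≡.sym πq≡πp))

  _∨D_ : Elt → Elt → Elt
  ((x , true)  , x∈X) ∨D ((y , _)     , _)   = (x ∨ y , true) , a≤⇒InX (≤-trans (InX⇒a≤ x∈X) (x≤x∨y x y))
  ((x , false) , _)   ∨D ((y , true)  , y∈X) = (x ∨ y , true) , a≤⇒InX (≤-trans (InX⇒a≤ y∈X) (y≤x∨y x y))
  ((x , false) , _)   ∨D ((y , false) , _)   = ⌊ x ∨ y ⌋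

  ∨D-supremum : Supremum _≤D_ _∨D_
  ∨D-supremum ((x , true) , _) ((y , ε) , _) =
    (x≤x∨y x y , b≤b) , (y≤x∨y x y , Bool.≤-maximum ε) , λ _ (x≤u , ≤u) (y≤u , _) → ∨-least x≤u y≤u , ≤u
  ∨D-supremum ((x , false) , _) ((y , true) , _) =
    (x≤x∨y x y , f≤t) , (y≤x∨y x y , b≤b) , λ _ (x≤u , _) (y≤u , ≤u) → ∨-least x≤u y≤u , ≤u
  ∨D-supremum p@((x , false) , _) q@((y , false) , _) =
    level₀-≤D {p} {⌊ x ∨ y ⌋} refl (≤-trans (x≤x∨y x y) (≤-reflexive (≡.sym π-⌊⌋))) ,
    level₀-≤D {q} {⌊ x ∨ y ⌋} refl (≤-trans (y≤x∨y x y) (≤-reflexive (≡.sym π-⌊⌋))) ,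
    λ u (x≤u , _) (y≤u , _) → ⌊⌋-least u (∨-least x≤u y≤u)

  isBoundedJoinSemilatticeD : IsBoundedJoinSemilattice _≈D_ _≤D_ _∨D_ ⌊ bottom a ⌋
  isBoundedJoinSemilatticeD = record
    { isJoinSemilattice = record { isPartialOrder = isPartialOrderD ; supremum = ∨D-supremum }
    ; minimum           = λ p → ⌊⌋-least p (bottom-minimum a (π p))
    }

  -- Every element is the least or the greatest element of its fibre.
  elementsD : List Elt
  elementsD = map ⌊_⌋ (allFin n) ++ map ⌈_⌉ (allFin n)

  elementsD-complete : ∀ p → ∃[ q ] q ∈ elementsD × p ≈D q
  elementsD-complete p@((x , false) , _) =
    ⌊ x ⌋ , ∈-++⁺ˡ (∈-map⁺ ⌊_⌋ (∈-allFin x)) , ≤D-antisym {p} {⌊ x ⌋}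
      (level₀-≤D {p} {⌊ x ⌋} refl (≤-reflexive (≡.sym π-⌊⌋))) (⌊⌋-least p ≤-refl)
  elementsD-complete p@((x , true) , _) =
    ⌈ x ⌉ , ∈-++⁺ʳ _ (∈-map⁺ ⌈_⌉ (∈-allFin x)) , ≤D-antisym {p} {⌈ x ⌉}
      (⌈⌉-greatest p ≤-refl) (level₁-≤D {⌈ x ⌉} {p} refl (≤-reflexive π-⌈⌉))

  module Doubled = FiniteJoinSemilattice isBoundedJoinSemilatticeD _≈D?_ _≤D?_ elementsD elementsD-complete

  π-join₂ : ∀ {p q u} → Doubled.IsJoin₂ p q u → Base.IsJoin₂ (π p) (π q) (π u)
  π-join₂ {p} {q} {u} (p≤u , q≤u , least) = proj₁ p≤u , proj₁ q≤u ,
    λ t p≤t q≤t → ≤⌈⌉⇒ {u} (least ⌈ t ⌉ (⌈⌉-greatest p p≤t) (⌈⌉-greatest q q≤t))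

  π-meet₂ : ∀ {p q u} → Doubled.IsMeet₂ p q u → Base.IsMeet₂ (π p) (π q) (π u)
  π-meet₂ {p} {q} {u} (u≤p , u≤q , greatest) = proj₁ u≤p , proj₁ u≤q ,
    λ t t≤p t≤q → ⌊⌋≤⇒ {p = u} (greatest ⌊ t ⌋ (⌊⌋-least p t≤p) (⌊⌋-least q t≤q))

  π[_] : Doubled.Subset → Base.Subset
  π[ T ] = record { mem = λ x → ∃[ t ] Doubled.mem T t × π t ≡ x ; resp = λ { refl t∈ → t∈ } }

  π-join : ∀ {T u} → Doubled.IsJoinOf T u → Base.IsJoinOf π[ T ] (π u)
  π-join {T} {u} (ub , least) = (λ { _ (t , t∈T , refl) → proj₁ (ub t t∈T) }) ,
    λ x bound → ≤⌈⌉⇒ {u} (least ⌈ x ⌉ λ t t∈T → ⌈⌉-greatest t (bound (π t) (t , t∈T , refl)))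

  ⌊_⌋ˢ : Base.Subset → Doubled.Subset
  ⌊ T ⌋ˢ = record
    { mem  = λ p → ∃[ t ] Base.mem T t × p ≈D ⌊ t ⌋
    ; resp = λ p≈q (t , t∈T , p≈⌊t⌋) → t , t∈T , ≡.trans (≡.sym p≈q) p≈⌊t⌋ }

  ⌊⌋-join : ∀ {T w} → Base.IsJoinOf T w → Doubled.IsJoinOf ⌊ T ⌋ˢ ⌊ w ⌋
  ⌊⌋-join {T} {w} (ub , least) =
    (λ p (t , t∈T , p≈⌊t⌋) → ≤D-trans {p} {⌊ t ⌋} {⌊ w ⌋} (≤D-reflexive {p} {⌊ t ⌋} p≈⌊t⌋)
                               (⌊⌋-least ⌊ w ⌋ (≤-trans (ub t t∈T) (≤-reflexive (≡.sym π-⌊⌋))))) ,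
    λ u bound → ⌊⌋-least u (least (π u) λ t t∈T → ⌊⌋≤⇒ {p = u} (bound ⌊ t ⌋ (t , t∈T , refl)))

  -- Semidistributivity

  meet-level₁ : ∀ {y z m} → Doubled.IsMeet₂ y z m → level y ≡ true → level z ≡ true → level m ≡ true
  meet-level₁ {y} {z} {m} meet@(m≤y , m≤z , greatest) y₁ z₁ =
    ≤D-level₁ {e} {m} (greatest e (level₁-≤D {e} {y} y₁ (proj₁ m≤y)) (level₁-≤D {e} {z} z₁ (proj₁ m≤z))) refl
    where
    e : Elt
    e = (π m , true) ,
        a≤⇒InX (proj₂ (proj₂ (π-meet₂ {y} {z} {m} meet)) a (level₁⇒a≤ {y} y₁) (level₁⇒a≤ {z} z₁))

  join-level₀ : ∀ {y z m} → Doubled.IsJoin₂ y z m → level y ≡ false → level z ≡ false →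
                a ≤ π y → a ≤ π z → level m ≡ false
  join-level₀ {y} {z} {m} join@(y≤m , z≤m , least) y₀ z₀ a≤y a≤z =
    ≤D-level₀ {m} {e} (least e (level₀-≤D {y} {e} y₀ (proj₁ y≤m)) (level₀-≤D {z} {e} z₀ (proj₁ z≤m))) refl
    where
    ≤b : ∀ {t} → level t ≡ false → a ≤ π t → π t ≤ b
    ≤b {t} t₀ a≤t = proj₂ (InD₀-below a≤t ≤-refl (level₀⇒InD₀ {t} t₀))
    e : Elt
    e = (π m , false) , inj₂ ( ≤-trans a≤y (proj₁ (π-join₂ {y} {z} {m} join))
                             , proj₂ (proj₂ (π-join₂ {y} {z} {m} join)) b (≤b {y} y₀ a≤y) (≤b {z} z₀ a≤z))

  joinSemidistributive : Base.JoinSemidistributive → Doubled.JoinSemidistributive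
  joinSemidistributive jsd x y z u m v x∨y@(x≤u , y≤u , least-y) x∨z@(_ , z≤u , least-z)
                       y∧z@(m≤y , _ , _) x∨m@(x≤v , m≤v , least-m) =
    ≤D-antisym {v} {u} (least-m u x≤u (≤D-trans {m} {y} {u} m≤y y≤u)) u≤v
    where
    πu≤πv : π u ≤ π v
    πu≤πv = ≤-reflexive (≡.sym (jsd _ _ _ _ _ _ (π-join₂ {x} {y} {u} x∨y) (π-join₂ {x} {z} {u} x∨z)
                                                  (π-meet₂ {y} {z} {m} y∧z) (π-join₂ {x} {m} {v} x∨m)))
    u≤v : u ≤D v
    u≤v with level-cases y | level-cases z
    ... | inj₁ y₀ | _       = least-y v x≤v (level₀-≤D {y} {v} y₀ (≤-trans (proj₁ y≤u) πu≤πv))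
    ... | inj₂ _  | inj₁ z₀ = least-z v x≤v (level₀-≤D {z} {v} z₀ (≤-trans (proj₁ z≤u) πu≤πv))
    ... | inj₂ y₁ | inj₂ z₁ =
      level₁-≤D {u} {v} (≤D-level₁ {m} {v} m≤v (meet-level₁ {y} {z} {m} y∧z y₁ z₁)) πu≤πv

  meetSemidistributive : Base.MeetSemidistributive → Doubled.MeetSemidistributive
  meetSemidistributive msd x y z u m v x∧y@(u≤x , u≤y , greatest-y) x∧z@(_ , u≤z , greatest-z)
                       y∨z@(y≤m , _ , _) x∧m@(v≤x , v≤m , greatest-m) =
    ≤D-antisym {v} {u} v≤u (greatest-m u u≤x (≤D-trans {u} {y} {m} u≤y y≤m))
    where
    πv≤πu : π v ≤ π u
    πv≤πu = ≤-reflexive (msd _ _ _ _ _ _ (π-meet₂ {x} {y} {u} x∧y) (π-meet₂ {x} {z} {u} x∧z)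
                                         (π-join₂ {y} {z} {m} y∨z) (π-meet₂ {x} {m} {v} x∧m))
    a≤above-u : level v ≡ true → ∀ {t} → u ≤D t → a ≤ π t
    a≤above-u v₁ u≤t = ≤-trans (level₁⇒a≤ {v} v₁) (≤-trans πv≤πu (proj₁ u≤t))
    v≤u : v ≤D u
    v≤u with level-cases v | level-cases y | level-cases z
    ... | inj₁ v₀ | _       | _       = level₀-≤D {v} {u} v₀ πv≤πu
    ... | inj₂ _  | inj₂ y₁ | _       = greatest-y v v≤x (level₁-≤D {v} {y} y₁ (≤-trans πv≤πu (proj₁ u≤y)))
    ... | inj₂ _  | inj₁ _  | inj₂ z₁ = greatest-z v v≤x (level₁-≤D {v} {z} z₁ (≤-trans πv≤πu (proj₁ u≤z)))
    ... | inj₂ v₁ | inj₁ y₀ | inj₁ z₀ = contradiction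
      (≡.trans (≡.sym v₁) (≤D-level₀ {v} {m} v≤m
        (join-level₀ {y} {z} {m} y∨z y₀ z₀ (a≤above-u v₁ {y} u≤y) (a≤above-u v₁ {z} u≤z))))
      λ ()

  fiberMin-joinIrreducible⁻ : ∀ {p j} → FiberMin p j → Doubled.JoinIrreducible p → Base.JoinIrreducible j
  fiberMin-joinIrreducible⁻ {p} {j} fp@(πp≡j , _) (nonBottom , binary) =
    (λ (_ , least) → nonBottom ((λ _ ()) , λ u _ → fiberMin-least {p} {j} {u} fp (least (π u) λ _ ())))
    , binary′
    where
    x≤p : ∀ {x} → x ≤ j → x ≤ π p
    x≤p x≤j = ≡.subst (_ ≤_) (≡.sym πp≡j) x≤j
    binary′ : ∀ x y → Base.IsJoin₂ x y j → j ≡ x ⊎ j ≡ y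
    binary′ x y (x≤j , y≤j , least)
      with binary ⌊ x ⌋ ⌊ y ⌋ ( ⌊⌋-least p (x≤p x≤j) , ⌊⌋-least p (x≤p y≤j)
                             , λ u x≤u y≤u → fiberMin-least {p} {j} {u} fp
                                 (least (π u) (⌊⌋≤⇒ {p = u} x≤u) (⌊⌋≤⇒ {p = u} y≤u)))
    ... | inj₁ p≈⌊x⌋ = inj₁ (≡.trans (≡.sym πp≡j) (≡.trans (≡.cong proj₁ p≈⌊x⌋) π-⌊⌋))
    ... | inj₂ p≈⌊y⌋ = inj₂ (≡.trans (≡.sym πp≡j) (≡.trans (≡.cong proj₁ p≈⌊y⌋) π-⌊⌋))

  fiberMin-joinIrreducible⁺ : ∀ {p j} → FiberMin p j → Base.JoinIrreducible j → Doubled.JoinIrreducible p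
  fiberMin-joinIrreducible⁺ {p} {j} fp@(πp≡j , _) (nonBottom , binary) =
    (λ (_ , least) → nonBottom ((λ _ ()) , λ u _ →
       ≡.subst (j ≤_) π-⌈⌉ (fiberMin-≤ {p} {j} {⌈ u ⌉} fp (least ⌈ u ⌉ λ _ ()))))
    , binary′
    where
    binary′ : ∀ x y → Doubled.IsJoin₂ x y p → p ≈D x ⊎ p ≈D y
    binary′ x y join@(x≤p , y≤p , _)
      with binary (π x) (π y) (≡.subst (Base.IsJoin₂ (π x) (π y)) πp≡j (π-join₂ {x} {y} {p} join))
    ... | inj₁ j≡x = inj₁ (≤D-antisym {p} {x} (fiberMin-least {p} {j} {x} fp (≤-reflexive j≡x)) x≤p)
    ... | inj₂ j≡y = inj₂ (≤D-antisym {p} {y} (fiberMin-least {p} {j} {y} fp (≤-reflexive j≡y)) y≤p)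

  joinIrreducible-classification : ∀ {p} → Doubled.JoinIrreducible p → FiberMin p (π p) ⊎ p ≈D a₁
  joinIrreducible-classification {p@((x , false) , _)} _ = inj₁ (fiberMin-level₀ {p} refl)
  joinIrreducible-classification {p@((x , true) , x∈X)} (_ , binary) with InD₀? x
  ... | no x₀∉D = inj₁ (refl , least)
    where
    least : ∀ q → π q ≡ x → p ≤D q
    least ((_ , true)  , _)    refl = ≤D-refl {p}
    least ((_ , false) , y₀∈D) refl = contradiction y₀∈D x₀∉D
  ... | yes x₀∈D with x ≟ a
  ...   | yes refl = inj₂ refl
  ...   | no  x≢a  with binary ((x , false) , x₀∈D) a₁ join
    where
    join : Doubled.IsJoin₂ ((x , false) , x₀∈D) a₁ p
    join = (≤-refl , f≤t) , (InX⇒a≤ x∈X , b≤b) , λ _ (x≤u , _) (_ , ≤u) → x≤u , ≤u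
  ...     | inj₁ ()
  ...     | inj₂ p≈a₁ = contradiction (≡.cong proj₁ p≈a₁) x≢a

  a₁-not-fiberMin : ∀ {q j} → FiberMin q j → ¬ q ≈D a₁
  a₁-not-fiberMin {(_ , true) , _} (refl , least) refl with least a₀ refl
  ... | _ , ()

  a₁-joinIrreducible : ∀ {q} → q ≈D a₁ → Doubled.JoinIrreducible q
  a₁-joinIrreducible {q@((_ , true) , _)} refl = nonBottom , binary
    where
    nonBottom : ¬ Doubled.IsJoinOf Doubled.∅ q
    nonBottom (_ , least) with least a₀ (λ _ ())
    ... | _ , ()
    level₁-below-q : ∀ {x} → x ≤D q → level x ≡ true → q ≈D x
    level₁-below-q {x} x≤q x₁ = ≡.sym (≤D-antisym {x} {q} x≤q (level₁-≤D {q} {x} x₁ (level₁⇒a≤ {x} x₁)))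
    binary : ∀ x y → Doubled.IsJoin₂ x y q → q ≈D x ⊎ q ≈D y
    binary x y (x≤q , y≤q , least) with level-cases x | level-cases y
    ... | inj₂ x₁ | _       = inj₁ (level₁-below-q {x} x≤q x₁)
    ... | inj₁ _  | inj₂ y₁ = inj₂ (level₁-below-q {y} y≤q y₁)
    ... | inj₁ x₀ | inj₁ y₀
      with least a₀ (level₀-≤D {x} {a₀} x₀ (proj₁ x≤q)) (level₀-≤D {y} {a₀} y₀ (proj₁ y≤q))
    ...   | _ , ()

  -- The canonical join graph

  refinesJoinReps-π : ∀ {p j ŵ} → FiberMin p j → Base.RefinesJoinReps j (π ŵ) → Doubled.RefinesJoinReps p ŵ
  refinesJoinReps-π {p} {j} {ŵ} fp refines T join with refines π[ T ] (π-join {T} {ŵ} join)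
  ... | _ , (t , t∈T , refl) , j≤t = t , t∈T , fiberMin-least {p} {j} {t} fp j≤t

  refinesJoinReps-⌊⌋ : ∀ {p j w} → FiberMin p j → Doubled.RefinesJoinReps p ⌊ w ⌋ → Base.RefinesJoinReps j w
  refinesJoinReps-⌊⌋ {p} {j} fp refines T join with refines ⌊ T ⌋ˢ (⌊⌋-join {T} join)
  ... | t̂ , (t , t∈T , t̂≈⌊t⌋) , p≤t̂ =
    t , t∈T , ≡.subst (j ≤_) (≡.trans (≡.cong proj₁ t̂≈⌊t⌋) π-⌊⌋) (fiberMin-≤ {p} {j} {t̂} fp p≤t̂)

  -- ⌊_⌋ is left adjoint to π, so it preserves joins.
  join-of-fiberMins : ∀ {p q j j′ ŵ} → FiberMin p j → FiberMin q j′ → Doubled.IsJoin₂ p q ŵ → ŵ ≈D ⌊ π ŵ ⌋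
  join-of-fiberMins {p} {q} {j} {j′} {ŵ} fp fq (p≤ŵ , q≤ŵ , least) =
    ≤D-antisym {ŵ} {⌊ π ŵ ⌋} (least ⌊ π ŵ ⌋ (below {p} {j} fp p≤ŵ) (below {q} {j′} fq q≤ŵ))
                             (⌊⌋-least ŵ ≤-refl)
    where
    below : ∀ {r k} → FiberMin r k → r ≤D ŵ → r ≤D ⌊ π ŵ ⌋
    below {r} {k} fr r≤ŵ = fiberMin-least {r} {k} {⌊ π ŵ ⌋} fr
      (≤-trans (fiberMin-≤ {r} {k} {ŵ} fr r≤ŵ) (≤-reflexive (≡.sym π-⌊⌋)))

  edgeData-fiberMin⁻ : ∀ {p q j j′} → FiberMin p j → FiberMin q j′ → Doubled.EdgeData p q → Base.EdgeData j j′
  edgeData-fiberMin⁻ {p} {q} {j} {j′} fp@(πp≡j , _) fq@(πq≡j′ , _) e = record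
    { p-irreducible = fiberMin-joinIrreducible⁻ {p} {j} fp p-irreducible
    ; q-irreducible = fiberMin-joinIrreducible⁻ {q} {j′} fq q-irreducible
    ; p≉q           = λ j≡j′ → p≉q (≤D-antisym {p} {q}
        (fiberMin-least {p} {j} {q} fp (≤-reflexive (≡.trans j≡j′ (≡.sym πq≡j′))))
        (fiberMin-least {q} {j′} {p} fq (≤-reflexive (≡.trans (≡.sym j≡j′) (≡.sym πp≡j)))))
    ; top           = π top
    ; isJoin        = ≡.subst₂ (λ x y → Base.IsJoin₂ x y (π top)) πp≡j πq≡j′ (π-join₂ {p} {q} {top} isJoin)
    ; top≰p         = λ w≤j → top≰p (top-below {p} (≡.subst (π top ≤_) (≡.sym πp≡j) w≤j))
    ; top≰q         = λ w≤j′ → top≰q (top-below {q} (≡.subst (π top ≤_) (≡.sym πq≡j′) w≤j′))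
    ; p-refines     = refinesJoinReps-⌊⌋ {p} {j} fp
                        (Doubled.refinesJoinReps-resp {p} {top} {⌊ π top ⌋} top≈⌊w⌋ p-refines)
    ; q-refines     = refinesJoinReps-⌊⌋ {q} {j′} fq
                        (Doubled.refinesJoinReps-resp {q} {top} {⌊ π top ⌋} top≈⌊w⌋ q-refines)
    }
    where
    open Doubled.EdgeData e
    top≈⌊w⌋ : top ≈D ⌊ π top ⌋
    top≈⌊w⌋ = join-of-fiberMins {p} {q} {j} {j′} {top} fp fq isJoin
    top-below : ∀ {r} → π top ≤ π r → top ≤D r
    top-below {r} w≤r =
      ≤D-trans {top} {⌊ π top ⌋} {r} (≤D-reflexive {top} {⌊ π top ⌋} top≈⌊w⌋) (⌊⌋-least r w≤r)

  edgeData-fiberMin⁺ : ∀ {p q j j′} → FiberMin p j → FiberMin q j′ → Base.EdgeData j j′ → Doubled.EdgeData p q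
  edgeData-fiberMin⁺ {p} {q} {j} {j′} fp@(πp≡j , _) fq@(πq≡j′ , _) e = record
    { p-irreducible = fiberMin-joinIrreducible⁺ {p} {j} fp p-irreducible
    ; q-irreducible = fiberMin-joinIrreducible⁺ {q} {j′} fq q-irreducible
    ; p≉q           = λ p≈q → p≉q (≡.trans (≡.sym πp≡j) (≡.trans (≡.cong proj₁ p≈q) πq≡j′))
    ; top           = ⌊ top ⌋
    ; isJoin        = fiberMin-least {p} {j} {⌊ top ⌋} fp (≤-trans j≤w (≤-reflexive (≡.sym π-⌊⌋))) ,
                      fiberMin-least {q} {j′} {⌊ top ⌋} fq (≤-trans j′≤w (≤-reflexive (≡.sym π-⌊⌋))) ,
                      λ u p≤u q≤u → ⌊⌋-least u
                        (least (π u) (fiberMin-≤ {p} {j} {u} fp p≤u) (fiberMin-≤ {q} {j′} {u} fq q≤u))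
    ; top≰p         = λ ⌊w⌋≤p → top≰p (≡.subst (top ≤_) πp≡j (⌊⌋≤⇒ {p = p} ⌊w⌋≤p))
    ; top≰q         = λ ⌊w⌋≤q → top≰q (≡.subst (top ≤_) πq≡j′ (⌊⌋≤⇒ {p = q} ⌊w⌋≤q))
    ; p-refines     = refinesJoinReps-π {p} {j} {⌊ top ⌋} fp
                        (≡.subst (Base.RefinesJoinReps j) (≡.sym π-⌊⌋) p-refines)
    ; q-refines     = refinesJoinReps-π {q} {j′} {⌊ top ⌋} fq
                        (≡.subst (Base.RefinesJoinReps j′) (≡.sym π-⌊⌋) q-refines)
    }
    where
    open Base.EdgeData e
    j≤w : j ≤ top
    j≤w = proj₁ isJoin
    j′≤w : j′ ≤ top
    j′≤w = proj₁ (proj₂ isJoin)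
    least : ∀ u → j ≤ u → j′ ≤ u → top ≤ u
    least = proj₂ (proj₂ isJoin)

  module NewEdgeFromEdge (jsd : Base.JoinSemidistributive) (em : ExcludedMiddle 0ℓ)
    {p q j} (e : Doubled.EdgeData p q) (fp : FiberMin p j) (q≈a₁ : q ≈D a₁) where
    open Doubled.EdgeData e

    q₁ : level q ≡ true
    q₁ = ≡.cong proj₂ q≈a₁

    πq≡a : π q ≡ a
    πq≡a = ≡.cong proj₁ q≈a₁

    top-least : ∀ u → p ≤D u → q ≤D u → top ≤D u
    top-least = proj₂ (proj₂ isJoin)

    p₀ : level p ≡ false
    p₀ with level-cases p
    ... | inj₁ p₀ = p₀
    ... | inj₂ p₁ = contradiction
      (top-least p (≤D-refl {p}) (level₁-≤D {q} {p} p₁ (≡.subst (_≤ π p) (≡.sym πq≡a) (level₁⇒a≤ {p} p₁))))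
      top≰p

    j≰a : ¬ j ≤ a
    j≰a j≤a =
      top≰q (top-least q (fiberMin-least {p} {j} {q} fp (≡.subst (j ≤_) (≡.sym πq≡a) j≤a)) (≤D-refl {q}))

    w : Carrier
    w = π top

    j∨a≡w : Base.IsJoin₂ j a w
    j∨a≡w = ≡.subst₂ (λ x y → Base.IsJoin₂ x y w) (proj₁ fp) πq≡a (π-join₂ {p} {q} {top} isJoin)

    a≤w : a ≤ w
    a≤w = proj₁ (proj₂ j∨a≡w)

    w-least : ∀ {x} → j ≤ x → a ≤ x → w ≤ x
    w-least = proj₂ (proj₂ j∨a≡w) _

    -- Otherwise top would also be the join of p and (a , 0), which q does not refine.
    w≤b : w ≤ b
    w≤b with w ≤? b
    ... | yes w≤b = w≤b
    ... | no  w≰b with q-refines (Doubled.pair p a₀) (Doubled.pair-join {p} {a₀} {top} join₀)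
      where
      above-top : ∀ u → p ≤D u → a₀ ≤D u → top ≤D u
      above-top u p≤u a₀≤u = by-level (level-cases u) (w-least (fiberMin-≤ {p} {j} {u} fp p≤u) (proj₁ a₀≤u))
        where
        by-level : level u ≡ false ⊎ level u ≡ true → w ≤ π u → top ≤D u
        by-level (inj₂ u₁) w≤u = level₁-≤D {top} {u} u₁ w≤u
        by-level (inj₁ u₀) w≤u = contradiction (proj₂ (InD₀-below a≤w w≤u (level₀⇒InD₀ {u} u₀))) w≰b
      join₀ : Doubled.IsJoin₂ p a₀ top
      join₀ = proj₁ isJoin , level₀-≤D {a₀} {top} refl a≤w , above-top
    ... | y , inj₁ y≈p  , q≤y = ⊥-elim (upper≰lower {q} {y} q₁ (≡.trans (≡.cong proj₂ y≈p) p₀) q≤y)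
    ... | y , inj₂ y≈a₀ , q≤y = ⊥-elim (upper≰lower {q} {y} q₁ (≡.cong proj₂ y≈a₀) q≤y)

    j-refines : Base.RefinesJoinReps j w
    j-refines T (ub , least) with p-refines T̂ (T̂-ub , T̂-least)
      where
      T̂ : Doubled.Subset
      T̂ = ⌊ T ⌋ˢ Doubled.∪ Doubled.single q
      T̂-ub : Doubled.UpperBound T̂ top
      T̂-ub x (inj₁ (t , t∈T , x≈⌊t⌋)) =
        ≤D-trans {x} {⌊ t ⌋} {top} (≤D-reflexive {x} {⌊ t ⌋} x≈⌊t⌋) (⌊⌋-least top (ub t t∈T))
      T̂-ub x (inj₂ x≈q) = ≤D-trans {x} {q} {top} (≤D-reflexive {x} {q} x≈q) (proj₁ (proj₂ isJoin))
      T̂-least : ∀ u → Doubled.UpperBound T̂ u → top ≤D u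
      T̂-least u bound = level₁-≤D {top} {u} (≤D-level₁ {q} {u} (bound q (inj₂ refl)) q₁)
        (least (π u) λ t t∈T → ⌊⌋≤⇒ {p = u} (bound ⌊ t ⌋ (inj₁ (t , t∈T , refl))))
    ... | y , inj₁ (t , t∈T , y≈⌊t⌋) , p≤y =
      t , t∈T , ≡.subst (j ≤_) (≡.trans (≡.cong proj₁ y≈⌊t⌋) π-⌊⌋) (fiberMin-≤ {p} {j} {y} fp p≤y)
    ... | y , inj₂ y≈q , p≤y =
      contradiction (≡.subst (j ≤_) (≡.trans (≡.cong proj₁ y≈q) πq≡a) (fiberMin-≤ {p} {j} {y} fp p≤y)) j≰a

    j-maximal : ∀ r → r ≤ w → Base.Essential r w → j ≤ r → r ≡ j
    j-maximal r r≤w ess j≤r with r̂-refines (Doubled.pair p q) (Doubled.pair-join {p} {q} {top} isJoin)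
      where
      r̂ : Elt
      r̂ = (r , false) , ≤b⇒InD₀ (≤-trans r≤w w≤b)
      r̂-refines : Doubled.RefinesJoinReps r̂ top
      r̂-refines = refinesJoinReps-π {r̂} {r} {top} (fiberMin-level₀ {r̂} refl)
                                    (Base.essential⇒refinesJoinReps em ess)
    ... | y , inj₁ y≈p , r≤y =
      ≤-antisym (≡.subst (r ≤_) (≡.trans (≡.cong proj₁ y≈p) (proj₁ fp)) (proj₁ r≤y)) j≤r
    ... | y , inj₂ y≈q , r≤y =
      contradiction (≤-trans j≤r (≡.subst (r ≤_) (≡.trans (≡.cong proj₁ y≈q) πq≡a) (proj₁ r≤y))) j≰a

    newEdge : proj₁ p ≡ (j , false) × NewEdgeFor j
    newEdge = ×-≡,≡→≡ (proj₁ fp , p₀) , (w , (a≤w , w≤b) , inCanonical) , j≰a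
      where
      inCanonical : InCan L j w
      inCanonical = Base.CanonicalJoinRepresentations.maximalEssential⇒inCanonical infimum jsd em
        (proj₁ j∨a≡w , Base.refinesJoinReps⇒essential j-refines , j-maximal)

  newEdge⇒edgeData : ∀ {p q j} → proj₁ p ≡ (j , false) → q ≈D a₁ → NewEdgeFor j → Doubled.EdgeData p q
  newEdge⇒edgeData {p} {q} {j} refl refl ((w₀ , (a≤w₀ , w₀≤b) , S , can , j∈S) , j≰a) = record
    { p-irreducible = fiberMin-joinIrreducible⁺ {p} {j} fp (Base.canonical⇒joinIrreducible {S} can j∈S)
    ; q-irreducible = a₁-joinIrreducible {q} refl
    ; p≉q           = λ ()
    ; top           = top
    ; isJoin        = (x≤x∨y j a , f≤t) , (y≤x∨y j a , b≤b) , λ u (j≤u , _) (a≤u , ≤u) → ∨-least j≤u a≤u , ≤u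
    ; top≰p         = upper≰lower {top} {p} refl refl
    ; top≰q         = λ top≤q → j≰a (≤-trans (x≤x∨y j a) (proj₁ top≤q))
    ; p-refines     = refinesJoinReps-π {p} {j} {top} fp
                        (Base.canonical⇒refinesJoinReps {S} em can j∈S (x≤x∨y j a) w≤w₀)
    ; q-refines     = q-refines
    }
    where
    em : ExcludedMiddle 0ℓ
    em = Base.canonical⇒excludedMiddle {S} can j∈S
    fp : FiberMin p j
    fp = fiberMin-level₀ {p} refl
    w≤w₀ : (j ∨ a) ≤ w₀
    w≤w₀ = ∨-least (proj₁ (proj₁ (proj₁ can)) j j∈S) a≤w₀
    top : Elt
    top = (j ∨ a , true) , a≤⇒InX (y≤x∨y j a)
    -- A representation of top without level-1 elements would have (j ∨ a , 0) as upper bound.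
    q-refines : Doubled.RefinesJoinReps q top
    q-refines T (ub , least) with em {∃[ t ] Doubled.mem T t × level t ≡ true}
    ... | yes (t , t∈T , t₁) = t , t∈T , level₁-≤D {q} {t} t₁ (level₁⇒a≤ {t} t₁)
    ... | no  none           = ⊥-elim (upper≰lower {top} {ŵ₀} refl refl (least ŵ₀ bound))
      where
      ŵ₀ : Elt
      ŵ₀ = (j ∨ a , false) , inj₂ (y≤x∨y j a , ≤-trans w≤w₀ w₀≤b)
      bound : Doubled.UpperBound T ŵ₀
      bound t t∈T with level-cases t
      ... | inj₁ t₀ = level₀-≤D {t} {ŵ₀} t₀ (proj₁ (ub t t∈T))
      ... | inj₂ t₁ = contradiction (t , t∈T , t₁) none

  edge⇒E′⊎NewEdge : ∀ {p q} → Base.JoinSemidistributive → Doubled.CanonicalJoinGraphEdge p q →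
          E′ L a b p q ⊎ NewEdge L a b p q
  edge⇒E′⊎NewEdge {p} {q} jsd edge =
    cases (joinIrreducible-classification {p} p-irreducible)
          (joinIrreducible-classification {q} q-irreducible)
    where
    e : Doubled.EdgeData p q
    e = Doubled.edge⇒edgeData edge
    open Doubled.EdgeData e using (p-irreducible; q-irreducible; p≉q)
    em : ExcludedMiddle 0ℓ
    em = Doubled.edge⇒excludedMiddle {p} {q} edge
    cases : FiberMin p (π p) ⊎ p ≈D a₁ → FiberMin q (π q) ⊎ q ≈D a₁ → E′ L a b p q ⊎ NewEdge L a b p q
    cases (inj₁ fp) (inj₁ fq) =
      inj₁ (π p , π q , Base.edgeData⇒edge (edgeData-fiberMin⁻ {p} {q} fp fq e) , fp , fq)
    cases (inj₁ fp) (inj₂ q≈a₁) =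
      let p≡ , new = NewEdgeFromEdge.newEdge jsd em e fp q≈a₁
      in  inj₂ (π p , new , inj₁ (p≡ , q≈a₁))
    cases (inj₂ p≈a₁) (inj₁ fq) =
      let q≡ , new = NewEdgeFromEdge.newEdge jsd em (Doubled.edgeData-swap e) fq p≈a₁
      in  inj₂ (π q , new , inj₂ (q≡ , p≈a₁))
    cases (inj₂ p≈a₁) (inj₂ q≈a₁) = contradiction (≡.trans p≈a₁ (≡.sym q≈a₁)) p≉q

  E′⊎NewEdge⇒edge : ∀ {p q} → E′ L a b p q ⊎ NewEdge L a b p q → Doubled.CanonicalJoinGraphEdge p q
  E′⊎NewEdge⇒edge {p} {q} (inj₁ (j , j′ , edge , fp , fq)) =
    Doubled.edgeData⇒edge (edgeData-fiberMin⁺ {p} {q} fp fq (Base.edge⇒edgeData edge))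
  E′⊎NewEdge⇒edge {p} {q} (inj₂ (_ , new , inj₁ (p≡ , q≈a₁))) =
    Doubled.edgeData⇒edge (newEdge⇒edgeData {p} {q} p≡ q≈a₁ new)
  E′⊎NewEdge⇒edge {p} {q} (inj₂ (_ , new , inj₂ (q≡ , p≈a₁))) =
    Doubled.edgeData⇒edge (Doubled.edgeData-swap (newEdge⇒edgeData {q} {p} q≡ p≈a₁ new))

  E′-NewEdge-disjoint : ∀ {p q} → ¬ (E′ L a b p q × NewEdge L a b p q)
  E′-NewEdge-disjoint {q = q} ((_ , j′ , _ , _ , fq) , (_ , _ , inj₁ (_ , q≈a₁))) =
    a₁-not-fiberMin {q} {j′} fq q≈a₁
  E′-NewEdge-disjoint {p = p} ((j , _ , _ , fp , _) , (_ , _ , inj₂ (_ , p≈a₁))) =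
    a₁-not-fiberMin {p} {j} fp p≈a₁

proposition4p9 : (L : FinLattice) → Semidistributive L →
    (a b : FinLattice.Carrier L) → FinLattice._≤_ L a b →
    DoubledSemidistributive L a b ×
    (∀ p q → DEdge L a b p q ⇔ (E′ L a b p q ⊎ NewEdge L a b p q)) ×
    (∀ p q → ¬ (E′ L a b p q × NewEdge L a b p q))
proposition4p9 L (jsd , msd) a b a≤b =
  (joinSemidistributive jsd , meetSemidistributive msd) ,
  (λ p q → mk⇔ (edge⇒E′⊎NewEdge {p} {q} jsd) (E′⊎NewEdge⇒edge {p} {q})) ,
  (λ p q → E′-NewEdge-disjoint {p} {q})
  where open DoubledLattice L a b a≤b
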